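{- Let $\omega\ge 4$ be an integer and let $\Gamma$ be a finite connected simple graph. Then $C_\omega(L(\Gamma))\cong \Gamma$ if and only if $\Gamma$ is $\omega$-regular.
   Context: The line graph $L(\Gamma)$ has the edges of $\Gamma$ as vertices, two being adjacent iff they share an endpoint in $\Gamma$. For a graph $H$ and integer $\omega$, the $\omega$-clique graph $C_\omega(H)$ is the graph whose vertices are the cliques of order $\omega$ in $H$ (sets of $\omega$ pairwise adjacent vertices), two distinct such cliques being adjacent iff they have nonempty intersection. -}

module Defs where

open import Level using (0ℓ)
open import Data.Nat using (ℕ)
open import Data.Bool using (Bool; true; false)
open import Data.Fin using (Fin)
open import Data.List using (List; length; filterᵇ; allFin)
open import Data.Product using (Σ; ∃; ∃-syntax; _×_; _,_; proj₁; proj₂)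
open import Data.Sum using (_⊎_)
open import Relation.Nullary using (¬_)
open import Relation.Binary.PropositionalEquality using (_≡_; _≢_)
open import Function.Bundles using (_⇔_)

record SimpleGraph (n : ℕ) : Set where
  field
    adj    : Fin n → Fin n → Bool
    sym    : ∀ i j → adj i j ≡ adj j i
    irrefl : ∀ i → adj i i ≡ false

module _ {n : ℕ} (Γ : SimpleGraph n) where
  open SimpleGraph Γ

  data Reach : Fin n → Fin n → Set where
    here : ∀ {i} → Reach i i
    step : ∀ {i j k} → adj i j ≡ true → Reach j k → Reach i k

  Connected : Set
  Connected = ∀ i j → Reach i j

  degree : Fin n → ℕ
  degree v = length (filterᵇ (adj v) (allFin n))

  Regular : ℕ → Set
  Regular d = ∀ v → degree v ≡ d

-- General graphs whose vertex "set" is a setoid (needed because the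
-- vertices of line graphs and clique graphs are sets of vertices/edges).

record Graph : Set₁ where
  field
    V       : Set
    _≈_     : V → V → Set
    ≈-refl  : ∀ {x} → x ≈ x
    ≈-sym   : ∀ {x y} → x ≈ y → y ≈ x
    ≈-trans : ∀ {x y z} → x ≈ y → y ≈ z → x ≈ z
    _~_     : V → V → Set
    ~-resp  : ∀ {x x' y y'} → x ≈ x' → y ≈ y' → x ~ y → x' ~ y'
    ~-sym   : ∀ {x y} → x ~ y → y ~ x
    ~-irr   : ∀ {x y} → x ~ y → ¬ (x ≈ y)

record _≅_ (G H : Graph) : Set where
  private
    module G = Graph G
    module H = Graph H
  field
    f      : G.V → H.V
    f-cong : ∀ {x y} → x G.≈ y → f x H.≈ f y
    f-inj  : ∀ {x y} → f x H.≈ f y → x G.≈ y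
    f-surj : ∀ y → ∃[ x ] (f x H.≈ y)
    f-adj  : ∀ x y → (x G.~ y) ⇔ (f x H.~ f y)

toGraph : ∀ {n} → SimpleGraph n → Graph
toGraph {n} Γ = record
  { V = Fin n ; _≈_ = _≡_
  ; ≈-refl = Eq.refl ; ≈-sym = Eq.sym ; ≈-trans = Eq.trans
  ; _~_ = λ i j → adj i j ≡ true
  ; ~-resp = λ { Eq.refl Eq.refl p → p }
  ; ~-sym = λ {i} {j} p → Eq.trans (sym j i) p
  ; ~-irr = λ { {i} p Eq.refl → bad (Eq.trans (Eq.sym (irrefl i)) p) }
  }
  where
  open SimpleGraph Γ
  import Relation.Binary.PropositionalEquality as Eq
  bad : false ≡ true → _
  bad ()

-- Line graph L(Γ): vertices are edges of Γ, given as ordered pairs (i , j)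
-- with i ~ j, where (i , j) and (j , i) are identified (same unordered edge).

module _ {n : ℕ} (Γ : SimpleGraph n) where
  open SimpleGraph Γ
  import Relation.Binary.PropositionalEquality as Eq
  open import Data.Sum using (inj₁; inj₂)

  Edge : Set
  Edge = Σ (Fin n × Fin n) λ p → adj (proj₁ p) (proj₂ p) ≡ true

  data SameEdge : Edge → Edge → Set where
    same : ∀ {i j p q} → SameEdge ((i , j) , p) ((i , j) , q)
    flip : ∀ {i j p q} → SameEdge ((i , j) , p) ((j , i) , q)

  data ShareEnd : Edge → Edge → Set where
    ll : ∀ {i j k p q} → ShareEnd ((i , j) , p) ((i , k) , q)
    lr : ∀ {i j k p q} → ShareEnd ((i , j) , p) ((k , i) , q)
    rl : ∀ {i j k p q} → ShareEnd ((j , i) , p) ((i , k) , q)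
    rr : ∀ {i j k p q} → ShareEnd ((j , i) , p) ((k , i) , q)

  private
    se-refl : ∀ {x} → SameEdge x x
    se-refl = same
    se-sym : ∀ {x y} → SameEdge x y → SameEdge y x
    se-sym same = same
    se-sym flip = flip
    se-trans : ∀ {x y z} → SameEdge x y → SameEdge y z → SameEdge x z
    se-trans same same = same
    se-trans same flip = flip
    se-trans flip same = flip
    se-trans flip flip = same
    shR : ∀ {x y y'} → SameEdge y y' → ShareEnd x y → ShareEnd x y'
    shR same ll = ll
    shR same lr = lr
    shR same rl = rl
    shR same rr = rr
    shR flip ll = lr
    shR flip lr = ll
    shR flip rl = rr
    shR flip rr = rl
    shL : ∀ {x x' y} → SameEdge x x' → ShareEnd x y → ShareEnd x' y
    shL same ll = ll
    shL same lr = lr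
    shL same rl = rl
    shL same rr = rr
    shL flip ll = rl
    shL flip lr = rr
    shL flip rl = ll
    shL flip rr = lr
    sh-resp : ∀ {x x' y y'} → SameEdge x x' → SameEdge y y' → ShareEnd x y → ShareEnd x' y'
    sh-resp p q s = shR q (shL p s)
    shsym : ∀ {x y} → ShareEnd x y → ShareEnd y x
    shsym ll = ll
    shsym lr = rl
    shsym rl = lr
    shsym rr = rr

  LineGraph : Graph
  LineGraph = record
    { V = Edge ; _≈_ = SameEdge
    ; ≈-refl = se-refl ; ≈-sym = se-sym ; ≈-trans = se-trans
    ; _~_ = λ x y → ¬ SameEdge x y × ShareEnd x y
    ; ~-resp = λ p q (ne , s) → (λ e → ne (se-trans p (se-trans e (se-sym q)))) , sh-resp p q s
    ; ~-sym = λ (ne , s) → (λ e → ne (se-sym e)) , shsym s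
    ; ~-irr = λ (ne , _) e → ne e
    }

-- A clique is presented by a listing
-- c : Fin ω → V(H) with c a ~ c b for a ≢ b (hence the c a are pairwise
-- distinct, so the underlying set has exactly ω elements); two listings
-- are identified iff they have the same underlying set.

module _ (ω : ℕ) (H : Graph) where
  open Graph H

  Clique : Set
  Clique = Σ (Fin ω → V) λ c → ∀ a b → a ≢ b → c a ~ c b

  _∈C_ : V → Clique → Set
  x ∈C (c , _) = ∃[ a ] (x ≈ c a)

  SameClique : Clique → Clique → Set
  SameClique C D = ∀ x → (x ∈C C → x ∈C D) × (x ∈C D → x ∈C C)

  Meet : Clique → Clique → Set
  Meet C D = ∃[ x ] (x ∈C C × x ∈C D)

  private
    ∈-resp : ∀ {x y} C → x ≈ y → x ∈C C → y ∈C C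
    ∈-resp C p (a , q) = a , ≈-trans (≈-sym p) q
    sc-trans : ∀ {C D E} → SameClique C D → SameClique D E → SameClique C E
    sc-trans p q x = (λ m → proj₁ (q x) (proj₁ (p x) m)) , (λ m → proj₂ (p x) (proj₂ (q x) m))
    sc-sym : ∀ {C D} → SameClique C D → SameClique D C
    sc-sym p x = proj₂ (p x) , proj₁ (p x)

  CliqueGraph : Graph
  CliqueGraph = record
    { V = Clique ; _≈_ = SameClique
    ; ≈-refl = λ x → (λ m → m) , (λ m → m)
    ; ≈-sym = λ {C} {D} → sc-sym {C} {D}
    ; ≈-trans = λ {C} {D} {E} → sc-trans {C} {D} {E}
    ; _~_ = λ C D → ¬ SameClique C D × Meet C D
    ; ~-resp = λ {C} {C'} {D} {D'} p q (ne , (x , m , m')) →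
        (λ e → ne (sc-trans {C} {C'} {D} p (sc-trans {C'} {D'} {D} e (sc-sym {D} {D'} q))))
        , (x , proj₁ (p x) m , proj₁ (q x) m')
    ; ~-sym = λ {C} {D} (ne , (x , m , m')) → (λ e → ne (sc-sym {D} {C} e)) , (x , m' , m)
    ; ~-irr = λ (ne , _) e → ne e
    }

{-# OPTIONS --safe #-}
module Submission where

-- An ω-clique of L(Γ) is a set of ω pairwise meeting edges. For ω ≥ 4 they all pass through one
-- vertex, their centre: an edge meeting the three sides of a triangle is one of them. If Γ is
-- ω-regular, every vertex is the centre of exactly one ω-clique, and sending a clique to its
-- centre is the isomorphism.
--
-- Conversely, let φ : C_ω(L(Γ)) ≅ Γ. If K is centred at v, exchanging one edge of K for one of the
-- d(v) − ω unused edges at v yields ω (d(v) − ω) distinct cliques adjacent to K, so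
-- d(φ K) ≥ ω (d(v) − ω). At a vertex of maximum degree this bounds every degree by ω + 1. A vertex
-- y of degree ω + 1 then has no neighbour of degree ≥ ω: two of them would give a clique at y with
-- ω + 2 neighbours, and one of them, u, makes φ K (for K centred at y and containing yu) a vertex
-- of degree ω + 1 with two such neighbours, namely the images of two exchanges of K. But then the
-- cliques centred at y are closed under adjacency, so by connectivity every clique is centred at
-- y, and φ⁻¹ of a neighbour u of y shows d(u) ≥ ω after all. Hence all degrees are at most ω, a
-- clique is determined by its centre, x ↦ centre (φ⁻¹ x) is injective and hence onto, and every
-- vertex has degree exactly ω.

open import Defs
open import Data.Nat using (ℕ; zero; suc; _+_; _*_; _∸_; _≤_; _<_; z≤n; s≤s)
import Data.Nat.Properties as ℕ
open import Data.Bool using (true; T?; _≟_)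
open import Data.Bool.Properties using (T-≡)
open import Data.Empty using (⊥; ⊥-elim)
open import Data.Fin as Fin using (Fin; zero; suc; punchOut; _↑ˡ_; _↑ʳ_)
import Data.Fin.Properties as Fin
open import Data.List using (List; length; lookup; filter; allFin)
open import Data.List.Extrema.Nat using (argmax; f[xs]≤f[argmax])
open import Data.List.Membership.Propositional using (_∈_)
open import Data.List.Membership.Propositional.Properties using (∈-lookup; ∈-filter⁺; ∈-filter⁻; ∈-allFin)
open import Data.List.Membership.Setoid.Properties using (index-injective)
open import Data.List.Relation.Unary.All as All using ()
open import Data.List.Relation.Unary.AllPairs using (_∷_)
open import Data.List.Relation.Unary.Any using (index)
open import Data.List.Relation.Unary.Any.Properties using (lookup-index)
open import Data.List.Relation.Unary.Unique.Propositional using (Unique)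
open import Data.List.Relation.Unary.Unique.Propositional.Properties using (allFin⁺; filter⁺)
open import Data.Product using (Σ; Σ-syntax; ∃-syntax; _×_; _,_; proj₁; proj₂; uncurry)
open import Data.Sum using (_⊎_; inj₁; inj₂; [_,_])
import Data.Vec.Functional as Vector
open import Data.Vec.Functional.Properties using (lookup-++ˡ; lookup-++ʳ)
open import Function using (_∘_)
open import Function.Bundles using (_⇔_; Equivalence; mk⇔)
open import Function.Definitions using (Injective)
open import Relation.Nullary using (¬_; Dec; yes; no; ¬?; _×-dec_)
open import Relation.Binary.PropositionalEquality
  using (_≡_; _≢_; refl; sym; trans; cong; subst; subst₂; setoid; module ≡-Reasoning)

*≤+⇒≤1 : ∀ i m → (3 + i) * m ≤ m + (3 + i) → m ≤ 1
*≤+⇒≤1 i zero          _       = z≤n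
*≤+⇒≤1 i (suc zero)    _       = ℕ.≤-refl
*≤+⇒≤1 i (suc (suc j)) ω*m≤m+ω = ⊥-elim (ℕ.<⇒≱ m+ω<ω*m ω*m≤m+ω)
  where
  m+ω<ω*m : (2 + j) + (3 + i) < (3 + i) * (2 + j)
  m+ω<ω*m = ℕ.+-monoʳ-< (2 + j)
    (ℕ.+-mono-≤ (ℕ.m≤m+n 2 j) (ℕ.+-mono-≤ (ℕ.m≤m+n 2 j) (ℕ.m≤m*n i (2 + j))))

remQuot-injective : ∀ {k} m → Injective _≡_ _≡_ (Fin.remQuot {k} m)
remQuot-injective {k} m {x} {y} eq = begin
  x                                         ≡⟨ sym (Fin.combine-remQuot {k} m x) ⟩
  uncurry Fin.combine (Fin.remQuot {k} m x) ≡⟨ cong (uncurry Fin.combine) eq ⟩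
  uncurry Fin.combine (Fin.remQuot {k} m y) ≡⟨ Fin.combine-remQuot {k} m y ⟩
  y                                         ∎
  where open ≡-Reasoning

Fin-injective⇒surjective : ∀ {m} (f : Fin m → Fin m) → Injective _≡_ _≡_ f → ∀ y → ∃[ x ] f x ≡ y
Fin-injective⇒surjective {suc m} f f-injective y with Fin.any? (λ x → f x Fin.≟ y)
... | yes hit = hit
... | no miss = ⊥-elim (ℕ.<-irrefl refl (Fin.injective⇒≤ punchOut∘f-injective))
  where
  y≢f : ∀ x → y ≢ f x
  y≢f x y≡fx = miss (x , sym y≡fx)
  punchOut∘f-injective : Injective _≡_ _≡_ (λ x → punchOut (y≢f x))
  punchOut∘f-injective eq = f-injective (Fin.punchOut-injective (y≢f _) (y≢f _) eq)

argmax-Fin : ∀ {n} (h : Fin n → ℕ) → Fin n → ∃[ u ] ∀ w → h w ≤ h u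
argmax-Fin {n} h v = argmax h v (allFin n) , λ w → All.lookup (f[xs]≤f[argmax] v (allFin n)) (∈-allFin w)

lookup-injective : ∀ {A : Set} {xs : List A} → Unique xs → Injective _≡_ _≡_ (lookup xs)
lookup-injective (_     ∷ _)      {zero}  {zero}  _  = refl
lookup-injective (x∉xs ∷ _)      {zero}  {suc j} eq = ⊥-elim (All.lookup x∉xs (∈-lookup j) eq)
lookup-injective (x∉xs ∷ _)      {suc i} {zero}  eq = ⊥-elim (All.lookup x∉xs (∈-lookup i) (sym eq))
lookup-injective (_     ∷ unique) {suc i} {suc j} eq = cong suc (lookup-injective unique eq)

module Enumeration {n : ℕ} {P : Fin n → Set} (P? : ∀ x → Dec (P x)) where

  members : List (Fin n)
  members = filter P? (allFin n)

  enumerate : Fin (length members) → Fin n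
  enumerate = lookup members

  enumerate-injective : Injective _≡_ _≡_ enumerate
  enumerate-injective = lookup-injective (filter⁺ P? (allFin⁺ n))

  enumerate-sound : ∀ i → P (enumerate i)
  enumerate-sound i = proj₂ (∈-filter⁻ P? {xs = allFin n} (∈-lookup i))

  ∈-members : ∀ {x} → P x → x ∈ members
  ∈-members {x} = ∈-filter⁺ P? (∈-allFin x)

  enumerate-complete : ∀ {x} → P x → ∃[ i ] enumerate i ≡ x
  enumerate-complete Px = index (∈-members Px) , sym (lookup-index (∈-members Px))

  injection⇒≤count : ∀ {m} (F : Fin m → Fin n) → Injective _≡_ _≡_ F → (∀ i → P (F i)) →
                     m ≤ length members
  injection⇒≤count F F-injective PF = Fin.injective⇒≤
    (F-injective ∘ index-injective (setoid (Fin n)) (∈-members (PF _)) (∈-members (PF _)))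

  covering⇒count≤ : ∀ {m} (G : Fin m → Fin n) → (∀ {x} → P x → ∃[ a ] G a ≡ x) → length members ≤ m
  covering⇒count≤ G covers = Fin.injective⇒≤ preimage-injective
    where
    preimage : Fin (length members) → _
    preimage i = proj₁ (covers (enumerate-sound i))
    preimage-injective : Injective _≡_ _≡_ preimage
    preimage-injective {i} {j} eq = enumerate-injective (begin
      enumerate i     ≡⟨ sym (proj₂ (covers (enumerate-sound i))) ⟩
      G (preimage i)  ≡⟨ cong G eq ⟩
      G (preimage j)  ≡⟨ proj₂ (covers (enumerate-sound j)) ⟩
      enumerate j     ∎)
      where open ≡-Reasoning

module Edges {n : ℕ} (Γ : SimpleGraph n) where
  open SimpleGraph Γ using (adj; irrefl) renaming (sym to adj-sym)

  infix 4 _∈ᵉ_ _∈ᵉ?_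

  Adj : Fin n → Fin n → Set
  Adj v w = adj v w ≡ true

  Adj? : ∀ v w → Dec (Adj v w)
  Adj? v w = adj v w ≟ true

  Adj-sym : ∀ {v w} → Adj v w → Adj w v
  Adj-sym {v} {w} v~w = trans (adj-sym w v) v~w

  Adj⇒≢ : ∀ {v w} → Adj v w → v ≢ w
  Adj⇒≢ {v} v~v refl with trans (sym (irrefl v)) v~v
  ... | ()

  module _ (v : Fin n) where
    open Enumeration (T? ∘ adj v)

    neighbour : Fin (degree Γ v) → Fin n
    neighbour = enumerate

    neighbour-injective : Injective _≡_ _≡_ neighbour
    neighbour-injective = enumerate-injective

    Adj-neighbour : ∀ i → Adj v (neighbour i)
    Adj-neighbour i = Equivalence.to T-≡ (enumerate-sound i)

    injection⇒≤degree : ∀ {m} (F : Fin m → Fin n) → Injective _≡_ _≡_ F → (∀ i → Adj v (F i)) →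
                        m ≤ degree Γ v
    injection⇒≤degree F F-injective v~F = injection⇒≤count F F-injective (Equivalence.from T-≡ ∘ v~F)

    covering⇒degree≤ : ∀ {m} (G : Fin m → Fin n) → (∀ {w} → Adj v w → ∃[ a ] G a ≡ w) → degree Γ v ≤ m
    covering⇒degree≤ G covers = covering⇒count≤ G (covers ∘ Equivalence.to T-≡)

  edge : ∀ {v w} → Adj v w → Edge Γ
  edge {v} {w} v~w = (v , w) , v~w

  edge-injective : ∀ {v w w′} (v~w : Adj v w) (v~w′ : Adj v w′) →
                   SameEdge Γ (edge v~w) (edge v~w′) → w ≡ w′
  edge-injective v~w v~w′ same = refl
  edge-injective v~w v~w′ flip = ⊥-elim (Adj⇒≢ v~w refl)

  SameEdge-refl : ∀ {e} → SameEdge Γ e e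
  SameEdge-refl = same

  SameEdge-sym : ∀ {e f} → SameEdge Γ e f → SameEdge Γ f e
  SameEdge-sym same = same
  SameEdge-sym flip = flip

  data _∈ᵉ_ (v : Fin n) : Edge Γ → Set where
    left  : ∀ {w p} → v ∈ᵉ ((v , w) , p)
    right : ∀ {u p} → v ∈ᵉ ((u , v) , p)

  _∈ᵉ?_ : ∀ v e → Dec (v ∈ᵉ e)
  v ∈ᵉ? ((i , j) , p) with v Fin.≟ i | v Fin.≟ j
  ... | yes refl | _        = yes left
  ... | no _     | yes refl = yes right
  ... | no v≢i   | no v≢j   = no λ { left → v≢i refl ; right → v≢j refl }

  ∈ᵉ-resp-SameEdge : ∀ {v e f} → SameEdge Γ e f → v ∈ᵉ e → v ∈ᵉ f
  ∈ᵉ-resp-SameEdge same left  = left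
  ∈ᵉ-resp-SameEdge same right = right
  ∈ᵉ-resp-SameEdge flip left  = right
  ∈ᵉ-resp-SameEdge flip right = left

  ∈ᵉ-two-ends : ∀ {e u w x} → u ≢ w → u ∈ᵉ e → w ∈ᵉ e → x ∈ᵉ e → x ≡ u ⊎ x ≡ w
  ∈ᵉ-two-ends u≢w left  left  _     = ⊥-elim (u≢w refl)
  ∈ᵉ-two-ends u≢w right right _     = ⊥-elim (u≢w refl)
  ∈ᵉ-two-ends u≢w left  right left  = inj₁ refl
  ∈ᵉ-two-ends u≢w left  right right = inj₂ refl
  ∈ᵉ-two-ends u≢w right left  left  = inj₂ refl
  ∈ᵉ-two-ends u≢w right left  right = inj₁ refl

  ends⇒SameEdge : ∀ {i j p f} → i ∈ᵉ f → j ∈ᵉ f → SameEdge Γ ((i , j) , p) f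
  ends⇒SameEdge {p = p} left  left  = ⊥-elim (Adj⇒≢ p refl)
  ends⇒SameEdge         left  right = same
  ends⇒SameEdge         right left  = flip
  ends⇒SameEdge {p = p} right right = ⊥-elim (Adj⇒≢ p refl)

  common-ends⇒SameEdge : ∀ {e f u w} → u ≢ w → u ∈ᵉ e → w ∈ᵉ e → u ∈ᵉ f → w ∈ᵉ f → SameEdge Γ e f
  common-ends⇒SameEdge {e} {f} u≢w u∈e w∈e u∈f w∈f = ends⇒SameEdge (end∈f left) (end∈f right)
    where
    end∈f : ∀ {x} → x ∈ᵉ e → x ∈ᵉ f
    end∈f x∈e with ∈ᵉ-two-ends u≢w u∈e w∈e x∈e
    ... | inj₁ refl = u∈f
    ... | inj₂ refl = w∈f

  ShareEnd⇒common-end : ∀ {e f} → ShareEnd Γ e f → ∃[ v ] v ∈ᵉ e × v ∈ᵉ f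
  ShareEnd⇒common-end ll = _ , left  , left
  ShareEnd⇒common-end lr = _ , left  , right
  ShareEnd⇒common-end rl = _ , right , left
  ShareEnd⇒common-end rr = _ , right , right

  common-end⇒ShareEnd : ∀ {v e f} → v ∈ᵉ e → v ∈ᵉ f → ShareEnd Γ e f
  common-end⇒ShareEnd left  left  = ll
  common-end⇒ShareEnd left  right = lr
  common-end⇒ShareEnd right left  = rl
  common-end⇒ShareEnd right right = rr

  opposite : ∀ {v e} → v ∈ᵉ e → Fin n
  opposite (left {w})  = w
  opposite (right {u}) = u

  opposite-∈ᵉ : ∀ {v e} (v∈e : v ∈ᵉ e) → opposite v∈e ∈ᵉ e
  opposite-∈ᵉ left  = right
  opposite-∈ᵉ right = left

  Adj-opposite : ∀ {v e} (v∈e : v ∈ᵉ e) → Adj v (opposite v∈e)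
  Adj-opposite (left {p = v~w})  = v~w
  Adj-opposite (right {p = u~v}) = Adj-sym u~v

  opposite-≢ : ∀ {v e} (v∈e : v ∈ᵉ e) → opposite v∈e ≢ v
  opposite-≢ v∈e = Adj⇒≢ (Adj-opposite v∈e) ∘ sym

  opposite-unique : ∀ {v w e} (v∈e : v ∈ᵉ e) → w ∈ᵉ e → w ≢ v → w ≡ opposite v∈e
  opposite-unique v∈e w∈e w≢v with ∈ᵉ-two-ends (opposite-≢ v∈e ∘ sym) v∈e (opposite-∈ᵉ v∈e) w∈e
  ... | inj₁ w≡v        = ⊥-elim (w≢v w≡v)
  ... | inj₂ w≡opposite = w≡opposite

  meets-at-opposite : ∀ {v e f} (v∈e : v ∈ᵉ e) → ¬ v ∈ᵉ f → ShareEnd Γ e f → opposite v∈e ∈ᵉ f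
  meets-at-opposite {v} v∈e v∉f e⌢f with ShareEnd⇒common-end e⌢f
  ... | x , x∈e , x∈f = subst (_∈ᵉ _) (opposite-unique v∈e x∈e x≢v) x∈f
    where
    x≢v : x ≢ v
    x≢v refl = v∉f x∈f

  meets-triangle⇒side : ∀ {u a b E₀ E₁ E₂ F} → u ≢ a → u ≢ b → a ≢ b →
    u ∈ᵉ E₀ → a ∈ᵉ E₀ → u ∈ᵉ E₁ → b ∈ᵉ E₁ → a ∈ᵉ E₂ → b ∈ᵉ E₂ →
    ShareEnd Γ F E₀ → ShareEnd Γ F E₁ → ShareEnd Γ F E₂ →
    SameEdge Γ F E₀ ⊎ SameEdge Γ F E₁ ⊎ SameEdge Γ F E₂
  meets-triangle⇒side u≢a u≢b a≢b u∈E₀ a∈E₀ u∈E₁ b∈E₁ a∈E₂ b∈E₂ F⌢E₀ F⌢E₁ F⌢E₂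
    with ShareEnd⇒common-end F⌢E₀ | ShareEnd⇒common-end F⌢E₁ | ShareEnd⇒common-end F⌢E₂
  ... | p , p∈F , p∈E₀ | q , q∈F , q∈E₁ | r , r∈F , r∈E₂
    with ∈ᵉ-two-ends u≢a u∈E₀ a∈E₀ p∈E₀ | ∈ᵉ-two-ends u≢b u∈E₁ b∈E₁ q∈E₁ | ∈ᵉ-two-ends a≢b a∈E₂ b∈E₂ r∈E₂
  ... | inj₁ refl | inj₁ refl | inj₁ refl = inj₁ (common-ends⇒SameEdge u≢a p∈F r∈F u∈E₀ a∈E₀)
  ... | inj₁ refl | inj₁ refl | inj₂ refl = inj₂ (inj₁ (common-ends⇒SameEdge u≢b p∈F r∈F u∈E₁ b∈E₁))
  ... | inj₁ refl | inj₂ refl | _         = inj₂ (inj₁ (common-ends⇒SameEdge u≢b p∈F q∈F u∈E₁ b∈E₁))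
  ... | inj₂ refl | inj₁ refl | _         = inj₁ (common-ends⇒SameEdge u≢a q∈F p∈F u∈E₀ a∈E₀)
  ... | inj₂ refl | inj₂ refl | _         = inj₂ (inj₂ (common-ends⇒SameEdge a≢b p∈F q∈F a∈E₂ b∈E₂))

Reach-closed : ∀ {n} (Γ : SimpleGraph n) (P : Fin n → Set) →
               (∀ {a b} → Edges.Adj Γ a b → P a → P b) → ∀ {a b} → Reach Γ a b → P a → P b
Reach-closed Γ P closed here         Pa = Pa
Reach-closed Γ P closed (step a~b r) Pa = Reach-closed Γ P closed r (closed a~b Pa)

record Neighbours (G : Graph) (x : Graph.V G) (m : ℕ) : Set where
  open Graph G
  field
    member   : Fin m → V
    adjacent : ∀ i → member i ~ x
    distinct : ∀ {i j} → i ≢ j → ¬ member i ≈ member j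

extend : ∀ {G x m} (N : Neighbours G x m) y → Graph._~_ G y x →
         (∀ i → ¬ Graph._≈_ G y (Neighbours.member N i)) → Neighbours G x (suc m)
extend {G} N y y~x y≉N = record
  { member   = y Vector.∷ member
  ; adjacent = λ { zero → y~x ; (suc i) → adjacent i }
  ; distinct = distinct′
  }
  where
  open Graph G
  open Neighbours N
  distinct′ : ∀ {i j} → i ≢ j → ¬ (y Vector.∷ member) i ≈ (y Vector.∷ member) j
  distinct′ {zero}  {zero}  0≢0 = ⊥-elim (0≢0 refl)
  distinct′ {zero}  {suc j} _   = y≉N j
  distinct′ {suc i} {zero}  _   = y≉N i ∘ ≈-sym
  distinct′ {suc i} {suc j} i≢j = distinct (i≢j ∘ cong suc)

≅⇒Neighbours≤degree : ∀ {G n} {Γ : SimpleGraph n} (iso : G ≅ toGraph Γ) {x m} →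
                      Neighbours G x m → m ≤ degree Γ (_≅_.f iso x)
≅⇒Neighbours≤degree {Γ = Γ} iso {x} N = injection⇒≤degree (f x) (f ∘ member) f∘member-injective
  (λ i → Adj-sym (Equivalence.to (f-adj _ _) (adjacent i)))
  where
  open _≅_ iso
  open Neighbours N
  open Edges Γ
  f∘member-injective : Injective _≡_ _≡_ (f ∘ member)
  f∘member-injective {i} {j} eq with i Fin.≟ j
  ... | yes i≡j = i≡j
  ... | no i≢j  = ⊥-elim (distinct i≢j (f-inj {member i} {member j} eq))

module CentredCliques {n : ℕ} (Γ : SimpleGraph n) (ω : ℕ) where
  open Edges Γ
  open Graph (LineGraph Γ) using () renaming (_~_ to _⌢ᴸ_; ~-sym to ⌢ᴸ-sym)

  infix 4 _∈ᶜ_ _∈ends_ _∈ends?_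

  𝒞 : Graph
  𝒞 = CliqueGraph ω (LineGraph Γ)

  open Graph 𝒞 public using () renaming (_≈_ to _≋_; _~_ to _⌢_)

  ωClique : Set
  ωClique = Clique ω (LineGraph Γ)

  edges : ωClique → Fin ω → Edge Γ
  edges = proj₁

  edges-distinct : ∀ K {a b} → a ≢ b → ¬ SameEdge Γ (edges K a) (edges K b)
  edges-distinct K a≢b = proj₁ (proj₂ K _ _ a≢b)

  _∈ᶜ_ : Edge Γ → ωClique → Set
  _∈ᶜ_ = _∈C_ ω (LineGraph Γ)

  _∈ends_ : Fin n → ωClique → Set
  w ∈ends K = ∃[ a ] w ∈ᵉ edges K a

  _∈ends?_ : ∀ w K → Dec (w ∈ends K)
  w ∈ends? K = Fin.any? (λ a → w ∈ᵉ? edges K a)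

  -- A record rather than a function type, so that K can be inferred from a proof of CentredAt v K.
  record CentredAt (v : Fin n) (K : ωClique) : Set where
    constructor centred
    field
      centre∈ : ∀ a → v ∈ᵉ edges K a
  open CentredAt public

  CentredAt-resp-≋ : ∀ {v K L} → K ≋ L → CentredAt v L → CentredAt v K
  CentredAt-resp-≋ {v} {K} {L} K≋L v∈L = centred λ a → v∈Ka a (proj₁ (K≋L (edges K a)) (a , SameEdge-refl))
    where
    v∈Ka : ∀ a → edges K a ∈ᶜ L → v ∈ᵉ edges K a
    v∈Ka a (b , Ka≈Lb) = ∈ᵉ-resp-SameEdge (SameEdge-sym Ka≈Lb) (centre∈ v∈L b)

  module _ {v K} (v∈K : CentredAt v K) where

    leaf : Fin ω → Fin n
    leaf a = opposite (centre∈ v∈K a)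

    Adj-leaf : ∀ a → Adj v (leaf a)
    Adj-leaf a = Adj-opposite (centre∈ v∈K a)

    leaf-∈ᵉ : ∀ a → leaf a ∈ᵉ edges K a
    leaf-∈ᵉ a = opposite-∈ᵉ (centre∈ v∈K a)

    leaf-injective : Injective _≡_ _≡_ leaf
    leaf-injective {a} {b} leafa≡leafb with a Fin.≟ b
    ... | yes a≡b = a≡b
    ... | no a≢b  = ⊥-elim (edges-distinct K a≢b (common-ends⇒SameEdge (Adj⇒≢ (Adj-leaf a))
          (centre∈ v∈K a) (leaf-∈ᵉ a) (centre∈ v∈K b) (subst (_∈ᵉ edges K b) (sym leafa≡leafb) (leaf-∈ᵉ b))))

    ∈ends⇒leaf : ∀ {w} → w ∈ends K → w ≢ v → ∃[ a ] leaf a ≡ w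
    ∈ends⇒leaf (a , w∈Ka) w≢v = a , sym (opposite-unique (centre∈ v∈K a) w∈Ka w≢v)

    centre≤degree : ω ≤ degree Γ v
    centre≤degree = injection⇒≤degree v leaf leaf-injective Adj-leaf

    neighbour∉ends⇒ω<degree : ∀ {w} → Adj v w → ¬ w ∈ends K → ω < degree Γ v
    neighbour∉ends⇒ω<degree {w} v~w w∉K = injection⇒≤degree v (w Vector.∷ leaf) cons-injective Adj-cons
      where
      Adj-cons : ∀ a → Adj v ((w Vector.∷ leaf) a)
      Adj-cons zero    = v~w
      Adj-cons (suc a) = Adj-leaf a
      leaf≢w : ∀ a → leaf a ≢ w
      leaf≢w a leaf≡w = w∉K (a , subst (_∈ᵉ edges K a) leaf≡w (leaf-∈ᵉ a))
      cons-injective : Injective _≡_ _≡_ (w Vector.∷ leaf)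
      cons-injective {zero}  {zero}  _         = refl
      cons-injective {zero}  {suc b} w≡leaf    = ⊥-elim (leaf≢w b (sym w≡leaf))
      cons-injective {suc a} {zero}  leaf≡w    = ⊥-elim (leaf≢w a leaf≡w)
      cons-injective {suc a} {suc b} leaf≡leaf = cong suc (leaf-injective leaf≡leaf)

  star : ∀ {v} (s : Fin ω → Fin n) → Injective _≡_ _≡_ s → (∀ a → Adj v (s a)) → ωClique
  star s s-injective v~s = (λ a → edge (v~s a)) ,
    λ a b a≢b → (a≢b ∘ s-injective ∘ edge-injective (v~s a) (v~s b)) , ll

  star-at : ∀ {v} → ω ≤ degree Γ v → Σ ωClique (CentredAt v)
  star-at {v} ω≤d = star s s-injective (λ _ → Adj-neighbour v _) , centred λ _ → left
    where
    s : Fin ω → Fin n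
    s a = neighbour v (Fin.inject≤ a ω≤d)
    s-injective : Injective _≡_ _≡_ s
    s-injective = Fin.inject≤-injective ω≤d ω≤d _ _ ∘ neighbour-injective v

  leaves-cover : ∀ {v K w} → CentredAt v K → degree Γ v ≡ ω → Adj v w → w ∈ends K
  leaves-cover {K = K} {w} v∈K d≡ω v~w with w ∈ends? K
  ... | yes w∈K = w∈K
  ... | no w∉K  = ⊥-elim (ℕ.<-irrefl (sym d≡ω) (neighbour∉ends⇒ω<degree v∈K v~w w∉K))

  centred-⊆ : ∀ {v K L} → CentredAt v K → CentredAt v L → degree Γ v ≡ ω → ∀ e → e ∈ᶜ K → e ∈ᶜ L
  centred-⊆ v∈K v∈L d≡ω e (a , e≈Ka) =
    let b , w∈Lb = leaves-cover v∈L d≡ω (Adj-opposite v∈e) in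
    b , common-ends⇒SameEdge (opposite-≢ v∈e ∘ sym) v∈e (opposite-∈ᵉ v∈e) (centre∈ v∈L b) w∈Lb
    where
    v∈e = ∈ᵉ-resp-SameEdge (SameEdge-sym e≈Ka) (centre∈ v∈K a)

  centred-unique : ∀ {v K L} → CentredAt v K → CentredAt v L → degree Γ v ≡ ω → K ≋ L
  centred-unique v∈K v∈L d≡ω e = centred-⊆ v∈K v∈L d≡ω e , centred-⊆ v∈L v∈K d≡ω e

  record FreshNeighbour (v : Fin n) (K : ωClique) : Set where
    field
      vertex   : Fin n
      adjacent : Adj v vertex
      fresh    : ¬ vertex ∈ends K

  fresh-neighbours : ∀ {v K m} → CentredAt v K → m + ω ≤ degree Γ v →
                     Σ[ z ∈ (Fin m → FreshNeighbour v K) ] Injective _≡_ _≡_ (FreshNeighbour.vertex ∘ z)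
  fresh-neighbours {v} {K} {m} v∈K m+ω≤d = z , Fin.inject≤-injective _ _ _ _ ∘ enumerate-injective
    where
    open Enumeration (λ w → Adj? v w ×-dec ¬? (w ∈ends? K))
    covered : ∀ {w} → Adj v w → ∃[ a ] (enumerate Vector.++ leaf v∈K) a ≡ w
    covered {w} v~w with w ∈ends? K
    ... | yes w∈K = let a , leaf≡w = ∈ends⇒leaf v∈K w∈K (Adj⇒≢ v~w ∘ sym) in
                    length members ↑ʳ a , trans (lookup-++ʳ enumerate (leaf v∈K) a) leaf≡w
    ... | no w∉K  = let j , enumerate≡w = enumerate-complete (v~w , w∉K) in
                    j ↑ˡ ω , trans (lookup-++ˡ enumerate (leaf v∈K) j) enumerate≡w
    m≤count : m ≤ length members
    m≤count = ℕ.+-cancelʳ-≤ ω m _ (ℕ.≤-trans m+ω≤d (covering⇒degree≤ v _ covered))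
    z : Fin m → FreshNeighbour v K
    z j = record
      { vertex   = enumerate (Fin.inject≤ j m≤count)
      ; adjacent = proj₁ (enumerate-sound _)
      ; fresh    = proj₂ (enumerate-sound _)
      }

  fresh-neighbour : ∀ {v K} → CentredAt v K → ω < degree Γ v → FreshNeighbour v K
  fresh-neighbour v∈K ω<d = proj₁ (fresh-neighbours {m = 1} v∈K ω<d) zero

  module Swap {v K} (v∈K : CentredAt v K) where
    open FreshNeighbour

    swapped : FreshNeighbour v K → Fin ω → Fin ω → Edge Γ
    swapped z i a with a Fin.≟ i
    ... | yes _ = edge (adjacent z)
    ... | no _  = edges K a

    swapped-here : ∀ (z : FreshNeighbour v K) i → swapped z i i ≡ edge (adjacent z)
    swapped-here z i with i Fin.≟ i
    ... | yes _  = refl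
    ... | no i≢i = ⊥-elim (i≢i refl)

    swapped-elsewhere : ∀ (z : FreshNeighbour v K) {i a} → a ≢ i → swapped z i a ≡ edges K a
    swapped-elsewhere z {i} {a} a≢i with a Fin.≟ i
    ... | yes a≡i = ⊥-elim (a≢i a≡i)
    ... | no _    = refl

    new⌢ᴸkept : ∀ (z : FreshNeighbour v K) a → edge (adjacent z) ⌢ᴸ edges K a
    new⌢ᴸkept z a = (λ new≈Ka → fresh z (a , ∈ᵉ-resp-SameEdge new≈Ka right)) ,
                    common-end⇒ShareEnd left (centre∈ v∈K a)

    swap : FreshNeighbour v K → Fin ω → ωClique
    swap z i = swapped z i , pairwise
      where
      pairwise : ∀ a b → a ≢ b → swapped z i a ⌢ᴸ swapped z i b
      pairwise a b a≢b with a Fin.≟ i | b Fin.≟ i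
      ... | yes refl | yes refl = ⊥-elim (a≢b refl)
      ... | yes refl | no _     = new⌢ᴸkept z b
      ... | no _     | yes refl = ⌢ᴸ-sym (new⌢ᴸkept z a)
      ... | no _     | no _     = proj₂ K a b a≢b

    swap-centred : ∀ (z : FreshNeighbour v K) i → CentredAt v (swap z i)
    swap-centred z i = centred v∈swapped
      where
      v∈swapped : ∀ a → v ∈ᵉ swapped z i a
      v∈swapped a with a Fin.≟ i
      ... | yes _ = left
      ... | no _  = centre∈ v∈K a

    new∈ᶜswap : ∀ (z : FreshNeighbour v K) i → edge (adjacent z) ∈ᶜ swap z i
    new∈ᶜswap z i = i , subst (SameEdge Γ _) (sym (swapped-here z i)) SameEdge-refl

    kept∈ᶜswap : ∀ (z : FreshNeighbour v K) {i a} → a ≢ i → edges K a ∈ᶜ swap z i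
    kept∈ᶜswap z {a = a} a≢i = a , subst (SameEdge Γ _) (sym (swapped-elsewhere z a≢i)) SameEdge-refl

    replaced∉ᶜswap : ∀ (z : FreshNeighbour v K) i → ¬ edges K i ∈ᶜ swap z i
    replaced∉ᶜswap z i (a , Ki≈a) with a Fin.≟ i
    ... | yes refl = fresh z (i , ∈ᵉ-resp-SameEdge (SameEdge-sym Ki≈a) right)
    ... | no a≢i   = edges-distinct K (a≢i ∘ sym) Ki≈a

    swap-⌢ : ∀ (z : FreshNeighbour v K) {i j} → j ≢ i → swap z i ⌢ K
    swap-⌢ z {i} {j} j≢i = swap≉K , edges K j , kept∈ᶜswap z j≢i , (j , SameEdge-refl)
      where
      swap≉K : ¬ swap z i ≋ K
      swap≉K swap≋K with proj₁ (swap≋K _) (new∈ᶜswap z i)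
      ... | a , new≈Ka = fresh z (a , ∈ᵉ-resp-SameEdge new≈Ka right)

    swap-≉-positions : ∀ (z z′ : FreshNeighbour v K) {i i′} → i ≢ i′ → ¬ swap z i ≋ swap z′ i′
    swap-≉-positions z z′ {i} i≢i′ swap≋swap =
      replaced∉ᶜswap z i (proj₂ (swap≋swap (edges K i)) (kept∈ᶜswap z′ i≢i′))

    swap-≉-vertices : ∀ (z z′ : FreshNeighbour v K) i → vertex z ≢ vertex z′ → ¬ swap z i ≋ swap z′ i
    swap-≉-vertices z z′ i z≢z′ swap≋swap with proj₁ (swap≋swap _) (new∈ᶜswap z i)
    ... | a , new≈a with a Fin.≟ i
    ...   | yes refl = z≢z′ (edge-injective (adjacent z) (adjacent z′) new≈a)
    ...   | no _     = fresh z (a , ∈ᵉ-resp-SameEdge new≈a right)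

module StarCliques {n : ℕ} (Γ : SimpleGraph n) (k : ℕ) where
  open Edges Γ
  open CentredCliques Γ (4 + k) public

  ω : ℕ
  ω = 4 + k

  other : Fin ω → Fin ω
  other zero    = suc zero
  other (suc _) = zero

  other-≢ : ∀ i → other i ≢ i
  other-≢ zero    ()
  other-≢ (suc _) ()

  fourth-index : (m : Fin ω) → ∃[ p ] p ≢ zero × p ≢ suc zero × p ≢ m
  fourth-index m with m Fin.≟ suc (suc zero)
  ... | yes refl = suc (suc (suc zero)) , (λ ()) , (λ ()) , (λ ())
  ... | no m≢2   = suc (suc zero) , (λ ()) , (λ ()) , m≢2 ∘ sym

  centre-unique : ∀ {u w K} → CentredAt u K → CentredAt w K → u ≡ w
  centre-unique {u} {w} {K} u∈K w∈K with u Fin.≟ w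
  ... | yes u≡w = u≡w
  ... | no u≢w  = ⊥-elim (edges-distinct K {zero} {suc zero} (λ ())
        (common-ends⇒SameEdge u≢w (centre∈ u∈K _) (centre∈ w∈K _) (centre∈ u∈K _) (centre∈ w∈K _)))

  different-centres⇒≉ : ∀ {u w K L} → CentredAt u K → CentredAt w L → u ≢ w → ¬ K ≋ L
  different-centres⇒≉ u∈K w∈L u≢w K≋L = u≢w (centre-unique u∈K (CentredAt-resp-≋ K≋L w∈L))

  -- The first two edges meet in v. An edge m missing v would close a triangle with them, and
  -- a fourth edge p cannot meet all three sides of that triangle.
  centre : ∀ K → Σ (Fin n) λ v → CentredAt v K
  centre K = v , centred v∈
    where
    c = edges K
    meet : ∀ {a b} → a ≢ b → ShareEnd Γ (c a) (c b)
    meet a≢b = proj₂ (proj₂ K _ _ a≢b)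
    common = ShareEnd⇒common-end (meet {zero} {suc zero} (λ ()))
    v = proj₁ common
    v∈c₀ = proj₁ (proj₂ common)
    v∈c₁ = proj₂ (proj₂ common)
    a≢b : opposite v∈c₀ ≢ opposite v∈c₁
    a≢b a≡b = edges-distinct K {zero} {suc zero} (λ ())
      (common-ends⇒SameEdge (opposite-≢ v∈c₀ ∘ sym) v∈c₀ (opposite-∈ᵉ v∈c₀) v∈c₁
        (subst (_∈ᵉ c (suc zero)) (sym a≡b) (opposite-∈ᵉ v∈c₁)))
    v∈ : ∀ m → v ∈ᵉ c m
    v∈ m with v ∈ᵉ? c m
    ... | yes v∈cm = v∈cm
    ... | no v∉cm with fourth-index m
    ...   | p , p≢0 , p≢1 , p≢m =
      ⊥-elim ([ edges-distinct K p≢0 , [ edges-distinct K p≢1 , edges-distinct K p≢m ] ]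
        (meets-triangle⇒side (opposite-≢ v∈c₀ ∘ sym) (opposite-≢ v∈c₁ ∘ sym) a≢b
          v∈c₀ (opposite-∈ᵉ v∈c₀) v∈c₁ (opposite-∈ᵉ v∈c₁)
          (meets-at-opposite v∈c₀ v∉cm (meet 0≢m)) (meets-at-opposite v∈c₁ v∉cm (meet 1≢m))
          (meet p≢0) (meet p≢1) (meet p≢m)))
      where
      0≢m : zero ≢ m
      0≢m refl = v∉cm v∈c₀
      1≢m : suc zero ≢ m
      1≢m refl = v∉cm v∈c₁

  -- Opaque: these constructions are only used through their types, and with-abstracting over
  -- their unfolded normal forms makes type checking blow up.
  opaque
    insert : ∀ {v K w} → CentredAt v K → Adj v w → ∀ i →
             Σ[ L ∈ ωClique ] CentredAt v L × w ∈ends L × (∀ a → a ≢ i → edges L a ≡ edges K a)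
    insert {v} {K} {w} v∈K v~w i with w ∈ends? K
    ... | yes w∈K = K , v∈K , w∈K , λ _ _ → refl
    ... | no w∉K  = swap z i , swap-centred z i , (i , w∈new) , λ _ → swapped-elsewhere z
      where
      open Swap v∈K
      z : FreshNeighbour v K
      z = record { vertex = w ; adjacent = v~w ; fresh = w∉K }
      w∈new : w ∈ᵉ edges (swap z i) i
      w∈new = subst (w ∈ᵉ_) (sym (swapped-here z i)) right

    centred-containing : ∀ {v w} → ω ≤ degree Γ v → Adj v w → Σ[ K ∈ ωClique ] CentredAt v K × w ∈ends K
    centred-containing ω≤d v~w with insert (proj₂ (star-at ω≤d)) v~w zero
    ... | K , v∈K , w∈K , _ = K , v∈K , w∈K

    centred-containing₂ : ∀ {v w₁ w₂} → ω ≤ degree Γ v → Adj v w₁ → Adj v w₂ →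
                          Σ[ K ∈ ωClique ] CentredAt v K × w₁ ∈ends K × w₂ ∈ends K
    centred-containing₂ {w₁ = w₁} ω≤d v~w₁ v~w₂ with centred-containing ω≤d v~w₁
    ... | K₁ , v∈K₁ , (p , w₁∈K₁p) with insert v∈K₁ v~w₂ (other p)
    ...   | K₂ , v∈K₂ , w₂∈K₂ , keeps =
      K₂ , v∈K₂ , (p , subst (w₁ ∈ᵉ_) (sym (keeps p (other-≢ p ∘ sym))) w₁∈K₁p) , w₂∈K₂

  centre-of : ωClique → Fin n
  centre-of K = proj₁ (centre K)

  centre-of-centred : ∀ K → CentredAt (centre-of K) K
  centre-of-centred K = proj₂ (centre K)

  centre-of-cong : ∀ {K L} → K ≋ L → centre-of K ≡ centre-of L
  centre-of-cong {K} {L} K≋L =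
    centre-unique (centre-of-centred K) (CentredAt-resp-≋ K≋L (centre-of-centred L))

  centre-of-injective : (∀ v → degree Γ v ≤ ω) → ∀ {K L} → centre-of K ≡ centre-of L → K ≋ L
  centre-of-injective d≤ω {K} {L} cK≡cL = centred-unique (centre-of-centred K)
    (subst (λ v → CentredAt v L) (sym cK≡cL) (centre-of-centred L))
    (ℕ.≤-antisym (d≤ω _) (centre≤degree (centre-of-centred K)))

  meeting-centres-adjacent : ∀ {u w K L} → CentredAt u K → CentredAt w L → u ≢ w →
                             Meet ω (LineGraph Γ) K L → Adj u w
  meeting-centres-adjacent u∈K w∈L u≢w (e , (a , e≈Ka) , (b , e≈Lb)) =
    subst (Adj _) (sym (opposite-unique u∈e w∈e (u≢w ∘ sym))) (Adj-opposite u∈e)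
    where
    u∈e = ∈ᵉ-resp-SameEdge (SameEdge-sym e≈Ka) (centre∈ u∈K a)
    w∈e = ∈ᵉ-resp-SameEdge (SameEdge-sym e≈Lb) (centre∈ w∈L b)

  centred-⌢ : ∀ {u w K L} → CentredAt u K → CentredAt w L → u ≢ w → w ∈ends K → u ∈ends L → K ⌢ L
  centred-⌢ {K = K} u∈K w∈L u≢w (a , w∈Ka) (b , u∈Lb) =
    different-centres⇒≉ u∈K w∈L u≢w ,
    edges K a , (a , SameEdge-refl) ,
    (b , common-ends⇒SameEdge u≢w (centre∈ u∈K a) w∈Ka u∈Lb (centre∈ w∈L b))

  module _ {v K} (v∈K : CentredAt v K) where
    open Swap v∈K

    swaps : FreshNeighbour v K → Neighbours 𝒞 K ω
    swaps z = record
      { member = swap z ; adjacent = λ i → swap-⌢ z (other-≢ i) ; distinct = swap-≉-positions z z }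

    swap-grid : ∀ {m} (z : Fin m → FreshNeighbour v K) →
                Injective _≡_ _≡_ (FreshNeighbour.vertex ∘ z) → Neighbours 𝒞 K (ω * m)
    swap-grid {m} z z-injective = record
      { member = member ; adjacent = λ _ → swap-⌢ _ (other-≢ _) ; distinct = distinct }
      where
      member : Fin (ω * m) → ωClique
      member x = swap (z (proj₂ (Fin.remQuot {ω} m x))) (proj₁ (Fin.remQuot {ω} m x))
      distinct-pairs : ∀ {i j i′ j′} → (i , j) ≢ (i′ , j′) → ¬ swap (z j) i ≋ swap (z j′) i′
      distinct-pairs {i} {j} {i′} {j′} ij≢ij′ with i Fin.≟ i′ | j Fin.≟ j′
      ... | yes refl | yes refl = ⊥-elim (ij≢ij′ refl)
      ... | yes refl | no j≢j′  = swap-≉-vertices (z j) (z j′) i (j≢j′ ∘ z-injective)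
      ... | no i≢i′  | _        = swap-≉-positions (z j) (z j′) i≢i′
      distinct : ∀ {x y} → x ≢ y → ¬ member x ≋ member y
      distinct x≢y = distinct-pairs (x≢y ∘ remQuot-injective m)

regular⇒≅ : ∀ {n} (Γ : SimpleGraph n) k → Regular Γ (4 + k) → CliqueGraph (4 + k) (LineGraph Γ) ≅ toGraph Γ
regular⇒≅ Γ k regular = record
  { f      = centre-of
  ; f-cong = λ {K} {L} → centre-of-cong {K} {L}
  ; f-inj  = λ {K} {L} → centre-of-injective (ℕ.≤-reflexive ∘ regular) {K} {L}
  ; f-surj = λ v → let K , v∈K = star-at (ℕ.≤-reflexive (sym (regular v))) in
                   K , centre-unique (centre-of-centred K) v∈K
  ; f-adj  = λ K L → mk⇔ (⌢⇒Adj K L) (Adj⇒⌢ K L)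
  }
  where
  open Edges Γ
  open StarCliques Γ k
  ⌢⇒Adj : ∀ K L → K ⌢ L → Adj (centre-of K) (centre-of L)
  ⌢⇒Adj K L (K≉L , K∩L) = meeting-centres-adjacent (centre-of-centred K) (centre-of-centred L)
    (K≉L ∘ centre-of-injective (ℕ.≤-reflexive ∘ regular) {K} {L}) K∩L
  Adj⇒⌢ : ∀ K L → Adj (centre-of K) (centre-of L) → K ⌢ L
  Adj⇒⌢ K L cK~cL = centred-⌢ (centre-of-centred K) (centre-of-centred L) (Adj⇒≢ cK~cL)
    (leaves-cover (centre-of-centred K) (regular _) cK~cL)
    (leaves-cover (centre-of-centred L) (regular _) (Adj-sym cK~cL))

module FromIsomorphism {n : ℕ} (Γ : SimpleGraph n) (k : ℕ)
                       (iso : CliqueGraph (4 + k) (LineGraph Γ) ≅ toGraph Γ) where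
  open Edges Γ
  open StarCliques Γ k
  open _≅_ iso renaming (f to φ)

  φ-adj : ∀ {K L} → K ⌢ L → Adj (φ K) (φ L)
  φ-adj {K} {L} = Equivalence.to (f-adj K L)

  φ-adj⁻¹ : ∀ {K L} → Adj (φ K) (φ L) → K ⌢ L
  φ-adj⁻¹ {K} {L} = Equivalence.from (f-adj K L)

  φ⁻¹ : Fin n → ωClique
  φ⁻¹ x = proj₁ (f-surj x)

  φ∘φ⁻¹ : ∀ x → φ (φ⁻¹ x) ≡ x
  φ∘φ⁻¹ x = proj₂ (f-surj x)

  Neighbours≤degree : ∀ {K m} → Neighbours 𝒞 K m → m ≤ degree Γ (φ K)
  Neighbours≤degree = ≅⇒Neighbours≤degree iso

  overfull-centre⇒ω≤degree : ∀ {v K} → CentredAt v K → ω < degree Γ v → ω ≤ degree Γ (φ K)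
  overfull-centre⇒ω≤degree v∈K ω<d = Neighbours≤degree (swaps v∈K (fresh-neighbour v∈K ω<d))

  degree≤suc-ω : ∀ v → degree Γ v ≤ suc ω
  degree≤suc-ω v with argmax-Fin (degree Γ) v
  ... | vₘ , ≤Δ = ℕ.≤-trans (≤Δ v) Δ≤suc-ω
    where
    Δ = degree Γ vₘ
    Δ≤suc-ω : Δ ≤ suc ω
    Δ≤suc-ω with ω ℕ.≤? Δ
    ... | no ω≰Δ  = ℕ.≤-trans (ℕ.<⇒≤ (ℕ.≰⇒> ω≰Δ)) (ℕ.n≤1+n ω)
    ... | yes ω≤Δ = subst (_≤ suc ω) m+ω≡Δ (ℕ.+-monoˡ-≤ ω m≤1)
      where
      m = Δ ∸ ω
      m+ω≡Δ : m + ω ≡ Δ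
      m+ω≡Δ = ℕ.m∸n+n≡m ω≤Δ
      K = proj₁ (star-at ω≤Δ)
      vₘ∈K = proj₂ (star-at ω≤Δ)
      z = fresh-neighbours vₘ∈K (ℕ.≤-reflexive m+ω≡Δ)
      m≤1 : m ≤ 1
      m≤1 = *≤+⇒≤1 (suc k) m (ℕ.≤-trans (Neighbours≤degree (swap-grid vₘ∈K (proj₁ z) (proj₂ z)))
                                          (subst (degree Γ (φ K) ≤_) (sym m+ω≡Δ) (≤Δ (φ K))))

  overfull-has-no-two-heavy-neighbours : ∀ {y w₁ w₂} → ω < degree Γ y → Adj y w₁ → Adj y w₂ → w₁ ≢ w₂ →
                                         ω ≤ degree Γ w₁ → ω ≤ degree Γ w₂ → ⊥
  overfull-has-no-two-heavy-neighbours ω<d y~w₁ y~w₂ w₁≢w₂ heavy₁ heavy₂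
    with centred-containing₂ (ℕ.<⇒≤ ω<d) y~w₁ y~w₂
       | centred-containing heavy₁ (Adj-sym y~w₁) | centred-containing heavy₂ (Adj-sym y~w₂)
  ... | K , y∈K , w₁∈K , w₂∈K | L₁ , w₁∈L₁ , y∈L₁ | L₂ , w₂∈L₂ , y∈L₂ =
    ℕ.<-irrefl refl (ℕ.≤-trans (Neighbours≤degree N) (degree≤suc-ω (φ K)))
    where
    z = fresh-neighbour y∈K ω<d
    open Swap y∈K using (swap-centred)
    N : Neighbours 𝒞 K (2 + ω)
    N = extend (extend (swaps y∈K z) L₁
          (centred-⌢ w₁∈L₁ y∈K (Adj⇒≢ y~w₁ ∘ sym) y∈L₁ w₁∈K)
          (λ i → different-centres⇒≉ w₁∈L₁ (swap-centred z i) (Adj⇒≢ y~w₁ ∘ sym))) L₂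
          (centred-⌢ w₂∈L₂ y∈K (Adj⇒≢ y~w₂ ∘ sym) y∈L₂ w₂∈K)
          λ { zero    → different-centres⇒≉ w₂∈L₂ w₁∈L₁ (w₁≢w₂ ∘ sym)
            ; (suc i) → different-centres⇒≉ w₂∈L₂ (swap-centred z i) (Adj⇒≢ y~w₂ ∘ sym) }

  overfull-has-no-heavy-neighbour : ∀ {y u} → ω < degree Γ y → Adj y u → ω ≤ degree Γ u → ⊥
  overfull-has-no-heavy-neighbour ω<d y~u heavy
    with centred-containing (ℕ.<⇒≤ ω<d) y~u | centred-containing heavy (Adj-sym y~u)
  ... | K , y∈K , u∈K | L , u∈L , y∈L =
    overfull-has-no-two-heavy-neighbours (Neighbours≤degree N)
      (Adj-sym (φ-adj (adjacent zero))) (Adj-sym (φ-adj (adjacent (suc zero))))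
      (λ φS₀≡φS₁ → distinct {zero} {suc zero} (λ ()) (f-inj {member zero} {member (suc zero)} φS₀≡φS₁))
      (swap-heavy zero) (swap-heavy (suc zero))
    where
    z = fresh-neighbour y∈K ω<d
    open Swap y∈K using (swap-centred)
    open Neighbours (swaps y∈K z)
    N : Neighbours 𝒞 K (suc ω)
    N = extend (swaps y∈K z) L (centred-⌢ u∈L y∈K (Adj⇒≢ y~u ∘ sym) y∈L u∈K)
          (λ i → different-centres⇒≉ u∈L (swap-centred z i) (Adj⇒≢ y~u ∘ sym))
    swap-heavy : ∀ i → ω ≤ degree Γ (φ (member i))
    swap-heavy i = overfull-centre⇒ω≤degree (swap-centred z i) ω<d

  module _ (connected : Connected Γ) where

    no-overfull-vertex : ∀ y → ¬ ω < degree Γ y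
    no-overfull-vertex y ω<d with Fin.any? (λ u → Adj? y u ×-dec ω ℕ.≤? degree Γ u)
    ... | yes (u , y~u , heavy) = overfull-has-no-heavy-neighbour ω<d y~u heavy
    ... | no no-heavy = no-heavy (u , Adj-neighbour y _ , u-heavy)
      where
      centred-closed : ∀ {K L} → CentredAt y K → K ⌢ L → CentredAt y L
      centred-closed {L = L} y∈K (_ , K∩L) with centre-of L Fin.≟ y
      ... | yes c≡y = subst (λ c → CentredAt c L) c≡y (centre-of-centred L)
      ... | no c≢y  = ⊥-elim (no-heavy (_ ,
            meeting-centres-adjacent y∈K (centre-of-centred L) (c≢y ∘ sym) K∩L ,
            centre≤degree (centre-of-centred L)))
      K₀ = proj₁ (star-at (ℕ.<⇒≤ ω<d))
      y∈K₀ = proj₂ (star-at (ℕ.<⇒≤ ω<d))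
      centred-step : ∀ {a b} → Adj a b → CentredAt y (φ⁻¹ a) → CentredAt y (φ⁻¹ b)
      centred-step {a} {b} a~b y∈a =
        centred-closed y∈a (φ-adj⁻¹ (subst₂ Adj (sym (φ∘φ⁻¹ a)) (sym (φ∘φ⁻¹ b)) a~b))
      every-centred : ∀ x → CentredAt y (φ⁻¹ x)
      every-centred x = Reach-closed Γ (λ x → CentredAt y (φ⁻¹ x)) centred-step (connected (φ K₀) x)
        (CentredAt-resp-≋ (f-inj {φ⁻¹ (φ K₀)} {K₀} (φ∘φ⁻¹ (φ K₀))) y∈K₀)
      u = neighbour y (Fin.fromℕ< (ℕ.≤-trans (s≤s z≤n) ω<d))
      u-heavy : ω ≤ degree Γ u
      u-heavy = subst (λ x → ω ≤ degree Γ x) (φ∘φ⁻¹ u) (overfull-centre⇒ω≤degree (every-centred u) ω<d)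

    degree≤ω : ∀ v → degree Γ v ≤ ω
    degree≤ω v = ℕ.≮⇒≥ (no-overfull-vertex v)

    centre-of∘φ⁻¹-injective : Injective _≡_ _≡_ (centre-of ∘ φ⁻¹)
    centre-of∘φ⁻¹-injective {x} {x′} eq = begin
      x           ≡⟨ sym (φ∘φ⁻¹ x) ⟩
      φ (φ⁻¹ x)   ≡⟨ f-cong {φ⁻¹ x} {φ⁻¹ x′} (centre-of-injective degree≤ω {φ⁻¹ x} {φ⁻¹ x′} eq) ⟩
      φ (φ⁻¹ x′)  ≡⟨ φ∘φ⁻¹ x′ ⟩
      x′          ∎
      where open ≡-Reasoning

    regular : Regular Γ ω
    regular v with Fin-injective⇒surjective (centre-of ∘ φ⁻¹) centre-of∘φ⁻¹-injective v
    ... | x , refl = ℕ.≤-antisym (degree≤ω _) (centre≤degree (centre-of-centred (φ⁻¹ x)))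

theorem5 : (ω : ℕ) → 4 ≤ ω → (n : ℕ) (Γ : SimpleGraph n) → Connected Γ →
           (CliqueGraph ω (LineGraph Γ) ≅ toGraph Γ) ⇔ Regular Γ ω
theorem5 (suc (suc (suc (suc k)))) (s≤s (s≤s (s≤s (s≤s z≤n)))) n Γ connected =
  mk⇔ (λ iso → FromIsomorphism.regular Γ k iso connected) (regular⇒≅ Γ k)
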